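{- Let $m\ge3$ be an integer, let $\beta=\frac{m+\sqrt{m^2-4}}{2}$ (the larger root of $x^2-mx+1$), and let $\mathbf U=(U_k)$ be given by $U_{ -1}=0$, $U_0=1$, $U_{k+1}=mU_k-U_{k-1}$ for $k\in\mathbb N$. Let $n$ be a positive integer whose $\mathbf U$-expansion is $(n)_{\mathbf U}=a_Na_{N-1}\cdots a_1a_0$. Then $$\bigl(\lfloor n/\beta\rfloor\bigr)_{\mathbf U}=a_Na_{N-1}\cdots a_1\qquad\text{and}\qquad d_\beta\bigl(\{n/\beta\}\bigr)=a_0a_1\cdots a_{N-1}a_N0^{\omega}.$$
   Context: The $\mathbf U$-expansion of a positive integer $n$ is the unique string $a_Na_{N-1}\cdots a_0$ of nonnegative integers with $a_N\neq0$, $n=\sum_{k=0}^N a_kU_k$, and $\sum_{k=0}^i a_kU_k<U_{i+1}$ for every $i\le N$ (obtained by the greedy algorithm); the $\mathbf U$-expansion of $0$ is the empty word (so when $N=0$, the string $a_N\cdots a_1$ is empty). For $x\in[0,1)$, the $\beta$-expansion $d_\beta(x)=(x_i)_{i\ge1}$ is defined by $x_i=\lfloor\beta T_\beta^{i-1}(x)\rfloor$, where $T_\beta(x)=\beta x-\lfloor\beta x\rfloor$; then $x=\sum_{i\ge1}x_i\beta^{ -i}$. $\{x\}=x-\lfloor x\rfloor$ is the fractional part. -}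

module Defs where

open import Data.Nat as ℕ using (ℕ; zero; suc; _∸_)
open import Data.Integer as ℤ using (ℤ; +_; _+_; _-_; _*_; -_; _≤_; _<_)
open import Data.List using (List; []; _∷_; _++_; [_]; take; length)
open import Data.Product using (Σ; _×_; ∃)
open import Data.Sum using (_⊎_)
open import Relation.Binary.PropositionalEquality using (_≡_; _≢_)

-- The sequence U (parameter m):  U₋₁ = 0, U₀ = 1, U_{k+1} = m U_k − U_{k−1}.
-- (For m ≥ 3 the true values are positive and increasing, so truncated
-- subtraction on ℕ computes them exactly.)

U : ℕ → ℕ → ℕ
U m zero = 1
U m (suc zero) = m
U m (suc (suc k)) = (m ℕ.* U m (suc k)) ∸ U m k

-- Digit strings are stored little-endian: the list  a₀ ∷ a₁ ∷ … ∷ a_N ∷ []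
-- represents the paper's string a_N a_{N−1} ⋯ a₀.

valueFrom : ℕ → List ℕ → ℕ → ℕ
valueFrom m [] o = 0
valueFrom m (a ∷ as) o = a ℕ.* U m o ℕ.+ valueFrom m as (suc o)

value : ℕ → List ℕ → ℕ
value m ds = valueFrom m ds 0

record UExp (m n : ℕ) (ds : List ℕ) : Set where
  field
    sums    : value m ds ≡ n
    leading : ds ≡ [] ⊎ Σ (List ℕ) (λ ds′ → Σ ℕ (λ a → ds ≡ ds′ ++ [ a ] × a ≢ 0))
    greedy  : (i : ℕ) → i ℕ.< length ds → value m (take (suc i) ds) ℕ.< U m (suc i)

digitOr0 : List ℕ → ℕ → ℕ
digitOr0 [] i = 0
digitOr0 (a ∷ as) zero = a
digitOr0 (a ∷ as) (suc i) = digitOr0 as i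

-- The ring ℤ[β], β = (m + √(m²−4))/2 the larger root of x² − m x + 1.
-- The pair (a , b) denotes the real number a + b β.  Since m ≥ 3, m² − 4
-- is not a perfect square, so this representation is unique.

record Zβ : Set where
  constructor _⊕_β
  field
    re : ℤ
    co : ℤ
open Zβ public

disc : ℕ → ℤ
disc m = (+ m * + m) - + 4

-- a + bβ = (u + b √D)/2 with u = 2a + b m.  Sign of u + v√D, decided
-- by comparing squares (the standard order on ℤ[√D] ⊆ ℝ).
NonNegSurd : ℤ → ℤ → ℤ → Set   -- D u v : u + v √D ≥ 0
NonNegSurd D u v =
  (+ 0 ≤ u × + 0 ≤ v)
  ⊎ (+ 0 ≤ u × v < + 0 × v * v * D ≤ u * u)
  ⊎ (u < + 0 × + 0 < v × u * u ≤ v * v * D)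

PosSurd : ℤ → ℤ → ℤ → Set      -- D u v : u + v √D > 0
PosSurd D u v =
  (+ 0 ≤ u × + 0 ≤ v × (+ 0 < u ⊎ + 0 < v))
  ⊎ (+ 0 ≤ u × v < + 0 × v * v * D < u * u)
  ⊎ (u < + 0 × + 0 < v × u * u < v * v * D)

uOf : ℕ → Zβ → ℤ
uOf m x = (+ 2 * re x) + (co x * + m)

NonNeg : ℕ → Zβ → Set
NonNeg m x = NonNegSurd (disc m) (uOf m x) (co x)

Pos : ℕ → Zβ → Set
Pos m x = PosSurd (disc m) (uOf m x) (co x)

ι : ℤ → Zβ
ι k = k ⊕ + 0 β

_−β_ : Zβ → Zβ → Zβ
x −β y = (re x - re y) ⊕ (co x - co y) β

-- multiplication by β (uses β² = mβ − 1):  β(a + bβ) = −b + (a + m b)β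
βtimes : ℕ → Zβ → Zβ
βtimes m x = (- co x) ⊕ (re x + + m * co x) β

_≤[_]_ : Zβ → ℕ → Zβ → Set
x ≤[ m ] y = NonNeg m (y −β x)

_<[_]_ : Zβ → ℕ → Zβ → Set
x <[ m ] y = Pos m (y −β x)

IsFloor : ℕ → Zβ → ℤ → Set
IsFloor m x k = (ι k ≤[ m ] x) × (x <[ m ] ι (k + + 1))

-- n / β = n (m − β) = n m − n β
divβ : ℕ → ℕ → Zβ
divβ m n = (+ (n ℕ.* m)) ⊕ (- (+ n)) β

-- d is the β-expansion d_β(x) = x₁ x₂ ⋯ , indexed from 0 (d i = x_{i+1}):
-- t 0 = x, d i = ⌊β t i⌋, t (i+1) = T_β (t i) = β t i − ⌊β t i⌋.
IsBetaExp : ℕ → Zβ → (ℕ → ℤ) → Set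
IsBetaExp m x d =
  Σ (ℕ → Zβ) λ t → (t 0 ≡ x)
    × ((i : ℕ) → IsFloor m (βtimes m (t i)) (d i)
                 × (t (suc i) ≡ βtimes m (t i) −β ι (d i)))

module Submission where

-- Since U_{i+1} − βU_i = β^{-(i+1)}, writing n = Σ aᵢUᵢ gives
--   n/β − Σ_{i≥1} aᵢU_{i−1} = Σ aᵢβ^{-(i+1)}.
-- The greedy inequalities of the U-expansion force a₀a₁⋯a_N to satisfy Parry's
-- condition for β (each digit is at most m − 1, and every digit m − 1 is followed by a
-- string lexicographically below (m − 2)^ω), so the right-hand side lies in [0, 1).
-- Hence it is the fractional part of n/β, its digits form the β-expansion, and the
-- integer part Σ_{i≥1} aᵢU_{i−1} has U-expansion a_N⋯a₁: the greedy inequalities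
-- survive the shift because U_o/U_{o+1} is increasing, by the d'Ocagne-type identity
-- U_{o+1}U_{o+d+1} = U_oU_{o+d+2} + U_d. The inequalities are decided in ℤ[β] by
-- the sign rule for u + v√D, D = m² − 4, which makes ℤ[β] an ordered ring.

open import Defs
import Data.Nat as ℕ
import Data.Integer as ℤ

module IntegerOrder where
  open import Data.Nat.Base using (z≤n; s≤s)
  open import Data.Integer.Base
  open import Data.Integer.Properties
  open import Data.Integer.Tactic.RingSolver using (solve-∀)
  open import Data.Sum using (inj₁; inj₂)
  open import Relation.Binary.PropositionalEquality
  open import Relation.Nullary using (yes; no)
  open import Data.Empty using (⊥-elim)

  private variable a b c d p q i j : ℤ

  0≤ℕ : ∀ n → 0ℤ ≤ + n
  0≤ℕ _ = +≤+ z≤n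

  0≤+ : 0ℤ ≤ i → 0ℤ ≤ j → 0ℤ ≤ i + j
  0≤+ = +-mono-≤

  0≤* : 0ℤ ≤ i → 0ℤ ≤ j → 0ℤ ≤ i * j
  0≤* {+ i} {+ j} _ _ = subst (0ℤ ≤_) (pos-* i j) (+≤+ z≤n)

  0<* : 0ℤ < i → 0ℤ < j → 0ℤ < i * j
  0<* (+<+ (s≤s _)) (+<+ (s≤s _)) = +<+ (s≤s z≤n)

  neg-square : ∀ i → - i * - i ≡ i * i
  neg-square = solve-∀

  0≤square : ∀ i → 0ℤ ≤ i * i
  0≤square i with ≤-total 0ℤ i
  ... | inj₁ 0≤i = 0≤* 0≤i 0≤i
  ... | inj₂ i≤0 = subst (0ℤ ≤_) (neg-square i) (0≤* (neg-mono-≤ i≤0) (neg-mono-≤ i≤0))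

  0<square-neg : i < 0ℤ → 0ℤ < i * i
  0<square-neg {i} i<0 = subst (0ℤ <_) (neg-square i) (0<* (neg-mono-< i<0) (neg-mono-< i<0))

  0≤-neg : i ≤ 0ℤ → 0ℤ ≤ - i
  0≤-neg = neg-mono-≤

  ≤-by : ∀ c → 0ℤ ≤ c → j ≡ i + c → i ≤ j
  ≤-by {j} {i} c 0≤c refl = subst (_≤ i + c) (+-identityʳ i) (+-monoʳ-≤ i 0≤c)

  <-by : ∀ c → 0ℤ ≤ c → j ≡ (1ℤ + i) + c → i < j
  <-by c 0≤c eq = suc[i]≤j⇒i<j (≤-by c 0≤c eq)

  0<j+1-i⇒i≤j : 0ℤ < j + 1ℤ - i → i ≤ j
  0<j+1-i⇒i≤j {j} {i} h = ≤-by _ (i≤j⇒0≤j-i (i<j⇒suc[i]≤j h)) (ring i j)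
    where
    ring : ∀ i j → j ≡ i + (j + 1ℤ - i - (1ℤ + 0ℤ))
    ring = solve-∀

  ≤+ : 0ℤ ≤ i → j ≤ i + j
  ≤+ {i} {j} 0≤i = i≤j+i j i {{nonNegative 0≤i}}

  i+j≤0⇒j≤-i : i + j ≤ 0ℤ → j ≤ - i
  i+j≤0⇒j≤-i {i} {j} h = ≤-by (- (i + j)) (0≤-neg h) (ring i j)
    where
    ring : ∀ i j → - i ≡ j + - (i + j)
    ring = solve-∀

  i+j<0⇒i<-j : i + j < 0ℤ → i < - j
  i+j<0⇒i<-j {i} {j} h = <-by (- (1ℤ + (i + j))) (0≤-neg (i<j⇒suc[i]≤j h)) (ring i j)
    where
    ring : ∀ i j → - j ≡ (1ℤ + i) + - (1ℤ + (i + j))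
    ring = solve-∀

  *-mono-≤-nonNeg : 0ℤ ≤ a → 0ℤ ≤ c → a ≤ b → c ≤ d → a * c ≤ b * d
  *-mono-≤-nonNeg {a} {c} {b} {d} 0≤a 0≤c a≤b c≤d = ≤-trans
    (*-monoʳ-≤-nonNeg c {{nonNegative 0≤c}} a≤b)
    (*-monoˡ-≤-nonNeg b {{nonNegative (≤-trans 0≤a a≤b)}} c≤d)

  square-mono-≤ : 0ℤ ≤ a → a ≤ b → a * a ≤ b * b
  square-mono-≤ 0≤a a≤b = *-mono-≤-nonNeg 0≤a 0≤a a≤b a≤b

  square-mono-< : 0ℤ ≤ a → a < b → a * a < b * b
  square-mono-< {a} {b} 0≤a a<b = ≤-<-trans
    (*-monoˡ-≤-nonNeg a {{nonNegative 0≤a}} (<⇒≤ a<b))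
    (*-monoʳ-<-pos b {{positive (≤-<-trans 0≤a a<b)}} a<b)

  square-cancel-< : 0ℤ ≤ b → a * a < b * b → a < b
  square-cancel-< {b} {a} 0≤b h with a <? b
  ... | yes a<b = a<b
  ... | no a≮b = ⊥-elim (≤⇒≯ (square-mono-≤ 0≤b (≮⇒≥ a≮b)) h)

  square-cancel-≤ : 0ℤ ≤ b → a * a ≤ b * b → a ≤ b
  square-cancel-≤ {b} {a} 0≤b h with a ≤? b
  ... | yes a≤b = a≤b
  ... | no a≰b = ⊥-elim (<⇒≱ (square-mono-< 0≤b (≰⇒> a≰b)) h)

  -- a √ p ≤ b √ q  states  a√p ≤ b√q  by squaring; it is meant for a, b ≥ 0.
  infix 4 _√_≤_√_
  record _√_≤_√_ (a p b q : ℤ) : Set where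
    constructor squared
    field unsquared : a * a * p ≤ b * b * q
  open _√_≤_√_ public

  √-trans : a √ p ≤ b √ q → b √ q ≤ c √ d → a √ p ≤ c √ d
  √-trans (squared h₁) (squared h₂) = squared (≤-trans h₁ h₂)

  √-mono : 0ℤ ≤ p → 0ℤ ≤ q → 0ℤ ≤ c → c ≤ a → 0ℤ ≤ b → b ≤ d →
           a √ p ≤ b √ q → c √ p ≤ d √ q
  √-mono {p} {q} 0≤p 0≤q 0≤c c≤a 0≤b b≤d (squared h) = squared (≤-trans
    (*-monoʳ-≤-nonNeg p {{nonNegative 0≤p}} (square-mono-≤ 0≤c c≤a))
    (≤-trans h (*-monoʳ-≤-nonNeg q {{nonNegative 0≤q}} (square-mono-≤ 0≤b b≤d))))

  private
    regroup : ∀ x y w → (x * x * w) * (y * y * w) ≡ (x * y * w) * (x * y * w)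
    regroup = solve-∀

  √-+ : 0ℤ ≤ p → 0ℤ ≤ q → 0ℤ ≤ b → 0ℤ ≤ d →
        a √ p ≤ b √ q → c √ p ≤ d √ q → (a + c) √ p ≤ (b + d) √ q
  √-+ {p} {q} {b} {d} {a} {c} 0≤p 0≤q 0≤b 0≤d (squared h₁) (squared h₂) =
    squared (subst₂ _≤_ (expand a c p) (expand b d q)
      (+-mono-≤ (+-mono-≤ h₁ h₂) (*-monoˡ-≤-nonNeg (+ 2) cross)))
    where
    expand : ∀ x y w → x * x * w + y * y * w + + 2 * (x * y * w) ≡ (x + y) * (x + y) * w
    expand = solve-∀
    cross : a * c * p ≤ b * d * q
    cross = square-cancel-≤ (0≤* (0≤* 0≤b 0≤d) 0≤q)
      (subst₂ _≤_ (regroup a c p) (regroup b d q)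
        (*-mono-≤-nonNeg (0≤* (0≤square a) 0≤p) (0≤* (0≤square c) 0≤p) h₁ h₂))

  √-subtract : 0ℤ ≤ p → 0ℤ ≤ q → 0ℤ ≤ d → d ≤ a →
               a √ p ≤ b √ q → c √ q ≤ d √ p → (a - d) √ p ≤ (b - c) √ q
  √-subtract {p} {q} {d} {a} {b} {c} 0≤p 0≤q 0≤d d≤a (squared h₁) (squared h₂)
    with (a - d) * (a - d) * p ≤? (b - c) * (b - c) * q
  ... | yes h = squared h
  -- Otherwise b√q = (b − c)√q + c√q < (a − d)√p + d√p = a√p, the cross terms
  -- being compared by squaring as in √-+.
  ... | no h = ⊥-elim (<⇒≱ too-big h₁)
    where
    P = a - d
    Q = b - c
    Q<P : Q * Q * q < P * P * p
    Q<P = ≰⇒> h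
    cross : Q * c * q ≤ P * d * p
    cross = square-cancel-≤ (0≤* (0≤* (i≤j⇒0≤j-i d≤a) 0≤d) 0≤p)
      (subst₂ _≤_ (regroup Q c q) (regroup P d p)
        (*-mono-≤-nonNeg (0≤* (0≤square Q) 0≤q) (0≤* (0≤square c) 0≤q) (<⇒≤ Q<P) h₂))
    expand : ∀ x y w → (x - y) * (x - y) * w + + 2 * ((x - y) * y * w) + y * y * w ≡ x * x * w
    expand = solve-∀
    too-big : b * b * q < a * a * p
    too-big = subst₂ _<_ (expand b c q) (expand a d p)
      (+-mono-<-≤ (+-mono-<-≤ Q<P (*-monoˡ-≤-nonNeg (+ 2) cross)) h₂)

module SurdOrder (D : ℤ.ℤ) (0<D : ℤ.0ℤ ℤ.< D) where
  open import Data.Nat.Base using (z≤n)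
  open import Data.Integer.Base
  open import Data.Integer.Properties hiding (pos-+)
  open import Data.Integer.Tactic.RingSolver using (solve-∀)
  open import Data.Empty using (⊥-elim)
  open import Data.Product using (_,_)
  open import Data.Sum using (_⊎_; inj₁; inj₂)
  open import Relation.Binary.PropositionalEquality
  open import Relation.Nullary using (¬_; yes; no)
  open IntegerOrder

  private variable u v u₁ v₁ u₂ v₂ c i : ℤ

  NNS PS : ℤ → ℤ → Set
  NNS = NonNegSurd D
  PS = PosSurd D

  pattern A 0≤u 0≤v = inj₁ (0≤u , 0≤v)
  pattern B 0≤u v<0 h = inj₂ (inj₁ (0≤u , v<0 , h))
  pattern C u<0 0<v h = inj₂ (inj₂ (u<0 , 0<v , h))

  0≤D : 0ℤ ≤ D
  0≤D = <⇒≤ 0<D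

  0≤1 : 0ℤ ≤ 1ℤ
  0≤1 = +≤+ z≤n

  toB : ∀ u v → v * v * D ≤ u * u → - v √ D ≤ u √ 1ℤ
  toB u v h = squared (subst₂ _≤_ (cong (_* D) (sym (neg-square v))) (sym (*-identityʳ (u * u))) h)

  fromB : ∀ u v → - v √ D ≤ u √ 1ℤ → v * v * D ≤ u * u
  fromB u v (squared h) = subst₂ _≤_ (cong (_* D) (neg-square v)) (*-identityʳ (u * u)) h

  toC : ∀ u v → u * u ≤ v * v * D → - u √ 1ℤ ≤ v √ D
  toC u v h = squared (subst (_≤ v * v * D) (trans (sym (neg-square u)) (sym (*-identityʳ (- u * - u)))) h)

  fromC : ∀ u v → - u √ 1ℤ ≤ v √ D → u * u ≤ v * v * D
  fromC u v (squared h) = subst (_≤ v * v * D) (trans (*-identityʳ (- u * - u)) (neg-square u)) h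

  A+B : 0ℤ ≤ u₁ → 0ℤ ≤ v₁ → 0ℤ ≤ u₂ → v₂ < 0ℤ → v₂ * v₂ * D ≤ u₂ * u₂ → NNS (u₁ + u₂) (v₁ + v₂)
  A+B {u₁} {v₁} {u₂} {v₂} 0≤u₁ 0≤v₁ 0≤u₂ v₂<0 h with 0ℤ ≤? v₁ + v₂
  ... | yes 0≤V = A (0≤+ 0≤u₁ 0≤u₂) 0≤V
  ... | no 0≰V = B (0≤+ 0≤u₁ 0≤u₂) (≰⇒> 0≰V) (fromB (u₁ + u₂) (v₁ + v₂)
          (√-mono 0≤D 0≤1 (0≤-neg (<⇒≤ (≰⇒> 0≰V))) (neg-mono-≤ (≤+ 0≤v₁)) 0≤u₂ (≤+ 0≤u₁) (toB u₂ v₂ h)))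

  A+C : 0ℤ ≤ u₁ → 0ℤ ≤ v₁ → u₂ < 0ℤ → 0ℤ < v₂ → u₂ * u₂ ≤ v₂ * v₂ * D → NNS (u₁ + u₂) (v₁ + v₂)
  A+C {u₁} {v₁} {u₂} {v₂} 0≤u₁ 0≤v₁ u₂<0 0<v₂ h with 0ℤ ≤? u₁ + u₂
  ... | yes 0≤U = A 0≤U (<⇒≤ (+-mono-≤-< 0≤v₁ 0<v₂))
  ... | no 0≰U = C (≰⇒> 0≰U) (+-mono-≤-< 0≤v₁ 0<v₂) (fromC (u₁ + u₂) (v₁ + v₂)
          (√-mono 0≤1 0≤D (0≤-neg (<⇒≤ (≰⇒> 0≰U))) (neg-mono-≤ (≤+ 0≤u₁)) (<⇒≤ 0<v₂) (≤+ 0≤v₁) (toC u₂ v₂ h)))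

  B+B : 0ℤ ≤ u₁ → v₁ < 0ℤ → v₁ * v₁ * D ≤ u₁ * u₁ →
        0ℤ ≤ u₂ → v₂ < 0ℤ → v₂ * v₂ * D ≤ u₂ * u₂ → NNS (u₁ + u₂) (v₁ + v₂)
  B+B {u₁} {v₁} {u₂} {v₂} 0≤u₁ v₁<0 h₁ 0≤u₂ v₂<0 h₂ =
    B (0≤+ 0≤u₁ 0≤u₂) (+-mono-< v₁<0 v₂<0) (fromB (u₁ + u₂) (v₁ + v₂)
      (subst (_√ D ≤ (u₁ + u₂) √ 1ℤ) (sym (neg-distrib-+ v₁ v₂))
        (√-+ 0≤D 0≤1 0≤u₁ 0≤u₂ (toB u₁ v₁ h₁) (toB u₂ v₂ h₂))))

  C+C : u₁ < 0ℤ → 0ℤ < v₁ → u₁ * u₁ ≤ v₁ * v₁ * D →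
        u₂ < 0ℤ → 0ℤ < v₂ → u₂ * u₂ ≤ v₂ * v₂ * D → NNS (u₁ + u₂) (v₁ + v₂)
  C+C {u₁} {v₁} {u₂} {v₂} u₁<0 0<v₁ h₁ u₂<0 0<v₂ h₂ =
    C (+-mono-< u₁<0 u₂<0) (+-mono-< 0<v₁ 0<v₂) (fromC (u₁ + u₂) (v₁ + v₂)
      (subst (_√ 1ℤ ≤ (v₁ + v₂) √ D) (sym (neg-distrib-+ u₁ u₂))
        (√-+ 0≤1 0≤D (<⇒≤ 0<v₁) (<⇒≤ 0<v₂) (toC u₁ v₁ h₁) (toC u₂ v₂ h₂))))

  B+C : 0ℤ ≤ u₁ → v₁ < 0ℤ → v₁ * v₁ * D ≤ u₁ * u₁ →
        u₂ < 0ℤ → 0ℤ < v₂ → u₂ * u₂ ≤ v₂ * v₂ * D → NNS (u₁ + u₂) (v₁ + v₂)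
  B+C {u₁} {v₁} {u₂} {v₂} 0≤u₁ v₁<0 h₁ u₂<0 0<v₂ h₂ with 0ℤ ≤? u₁ + u₂
  ... | yes 0≤U with 0ℤ ≤? v₁ + v₂
  ...   | yes 0≤V = A 0≤U 0≤V
  ...   | no 0≰V = B 0≤U (≰⇒> 0≰V) (fromB (u₁ + u₂) (v₁ + v₂)
            (subst₂ (λ a b → a √ D ≤ b √ 1ℤ) (ring v₁ v₂) (ring′ u₁ u₂)
              (√-subtract 0≤D 0≤1 (<⇒≤ 0<v₂) (i+j≤0⇒j≤-i (<⇒≤ (≰⇒> 0≰V))) (toB u₁ v₁ h₁) (toC u₂ v₂ h₂))))
    where
    ring : ∀ v₁ v₂ → - v₁ - v₂ ≡ - (v₁ + v₂)
    ring = solve-∀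
    ring′ : ∀ u₁ u₂ → u₁ - - u₂ ≡ u₁ + u₂
    ring′ = solve-∀
  B+C {u₁} {v₁} {u₂} {v₂} 0≤u₁ v₁<0 h₁ u₂<0 0<v₂ h₂ | no 0≰U with 0ℤ <? v₁ + v₂
  ...   | yes 0<V = C (≰⇒> 0≰U) 0<V (fromC (u₁ + u₂) (v₁ + v₂)
            (subst₂ (λ a b → a √ 1ℤ ≤ b √ D) (ring u₁ u₂) (ring′ v₁ v₂)
              (√-subtract 0≤1 0≤D 0≤u₁ (<⇒≤ (i+j<0⇒i<-j (≰⇒> 0≰U))) (toC u₂ v₂ h₂) (toB u₁ v₁ h₁))))
    where
    ring : ∀ u₁ u₂ → - u₂ - u₁ ≡ - (u₁ + u₂)
    ring = solve-∀
    ring′ : ∀ v₁ v₂ → v₂ - - v₁ ≡ v₁ + v₂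
    ring′ = solve-∀
  ...   | no 0≮V = ⊥-elim (<⇒≱ (*-monoʳ-<-pos 1ℤ (square-mono-< 0≤u₁ (i+j<0⇒i<-j (≰⇒> 0≰U))))
                                  (unsquared (√-trans (toC u₂ v₂ h₂) v₂√D≤u₁)))
    where
    v₂√D≤u₁ : v₂ √ D ≤ u₁ √ 1ℤ
    v₂√D≤u₁ = √-mono 0≤D 0≤1 (<⇒≤ 0<v₂) (i+j≤0⇒j≤-i (≮⇒≥ 0≮V)) 0≤u₁ ≤-refl (toB u₁ v₁ h₁)

  private
    swap : ∀ u₁ v₁ u₂ v₂ → NNS (u₂ + u₁) (v₂ + v₁) → NNS (u₁ + u₂) (v₁ + v₂)
    swap u₁ v₁ u₂ v₂ = subst₂ NNS (+-comm u₂ u₁) (+-comm v₂ v₁)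

  nonNeg-+ : NNS u₁ v₁ → NNS u₂ v₂ → NNS (u₁ + u₂) (v₁ + v₂)
  nonNeg-+ (A a₁ b₁) (A a₂ b₂) = A (0≤+ a₁ a₂) (0≤+ b₁ b₂)
  nonNeg-+ (A a₁ b₁) (B a₂ b₂ c₂) = A+B a₁ b₁ a₂ b₂ c₂
  nonNeg-+ (A a₁ b₁) (C a₂ b₂ c₂) = A+C a₁ b₁ a₂ b₂ c₂
  nonNeg-+ (B a₁ b₁ c₁) (B a₂ b₂ c₂) = B+B a₁ b₁ c₁ a₂ b₂ c₂
  nonNeg-+ (B a₁ b₁ c₁) (C a₂ b₂ c₂) = B+C a₁ b₁ c₁ a₂ b₂ c₂
  nonNeg-+ (C a₁ b₁ c₁) (C a₂ b₂ c₂) = C+C a₁ b₁ c₁ a₂ b₂ c₂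
  nonNeg-+ {u₁} {v₁} {u₂} {v₂} (B a₁ b₁ c₁) (A a₂ b₂) = swap u₁ v₁ u₂ v₂ (A+B a₂ b₂ a₁ b₁ c₁)
  nonNeg-+ {u₁} {v₁} {u₂} {v₂} (C a₁ b₁ c₁) (A a₂ b₂) = swap u₁ v₁ u₂ v₂ (A+C a₂ b₂ a₁ b₁ c₁)
  nonNeg-+ {u₁} {v₁} {u₂} {v₂} (C a₁ b₁ c₁) (B a₂ b₂ c₂) = swap u₁ v₁ u₂ v₂ (B+C a₂ b₂ c₂ a₁ b₁ c₁)

  private
    neg-square-D : ∀ v → - v * - v * D ≡ v * v * D
    neg-square-D v = cong (_* D) (neg-square v)
    0<-i⇒i<0 : ∀ i → 0ℤ < - i → i < 0ℤ
    0<-i⇒i<0 i = neg-cancel-< {0ℤ} {i}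
    -i<0⇒0<i : ∀ i → - i < 0ℤ → 0ℤ < i
    -i<0⇒0<i i = neg-cancel-< {i} {0ℤ}
    0≤-i⇒i≤0 : ∀ i → 0ℤ ≤ - i → i ≤ 0ℤ
    0≤-i⇒i≤0 i = neg-cancel-≤ {0ℤ} {i}

  nonNeg⇒¬negPos : NNS u v → ¬ PS (- u) (- v)
  nonNeg⇒¬negPos {u} (A 0≤u _) (A _ (_ , inj₁ 0<-u)) = <⇒≱ (0<-i⇒i<0 u 0<-u) 0≤u
  nonNeg⇒¬negPos {v = v} (A _ 0≤v) (A _ (_ , inj₂ 0<-v)) = <⇒≱ (0<-i⇒i<0 v 0<-v) 0≤v
  nonNeg⇒¬negPos {u} {v} (A 0≤u _) (B 0≤-u _ h) with ≤-antisym (0≤-i⇒i≤0 u 0≤-u) 0≤u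
  ... | refl = <⇒≱ h (0≤* (0≤square (- v)) 0≤D)
  nonNeg⇒¬negPos {v = v} (A _ 0≤v) (C _ 0<-v _) = <⇒≱ (0<-i⇒i<0 v 0<-v) 0≤v
  nonNeg⇒¬negPos {u} (B 0≤u _ _) (A _ (_ , inj₁ 0<-u)) = <⇒≱ (0<-i⇒i<0 u 0<-u) 0≤u
  nonNeg⇒¬negPos {u} (B 0≤u v<0 h) (A 0≤-u (_ , inj₂ _)) with ≤-antisym (0≤-i⇒i≤0 u 0≤-u) 0≤u
  ... | refl = <⇒≱ (0<* (0<square-neg v<0) 0<D) h
  nonNeg⇒¬negPos {v = v} (B _ v<0 _) (B _ -v<0 _) = <-asym v<0 (-i<0⇒0<i v -v<0)
  nonNeg⇒¬negPos {u} {v} (B _ _ h) (C _ _ h′) = <⇒≱ (subst₂ _<_ (neg-square u) (neg-square-D v) h′) h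
  nonNeg⇒¬negPos {v = v} (C _ 0<v _) (A _ (0≤-v , _)) = <⇒≱ 0<v (0≤-i⇒i≤0 v 0≤-v)
  nonNeg⇒¬negPos {u} {v} (C _ _ h) (B _ _ h′) = <⇒≱ (subst₂ _<_ (neg-square-D v) (neg-square u) h′) h
  nonNeg⇒¬negPos {u} (C u<0 _ _) (C -u<0 _ _) = <-asym u<0 (-i<0⇒0<i u -u<0)

  nonNeg⊎negPos : ∀ u v → NNS u v ⊎ PS (- u) (- v)
  nonNeg⊎negPos u v with 0ℤ ≤? u | 0ℤ ≤? v
  ... | yes 0≤u | yes 0≤v = inj₁ (A 0≤u 0≤v)
  ... | yes 0≤u | no 0≰v with v * v * D ≤? u * u
  ...   | yes h = inj₁ (B 0≤u (≰⇒> 0≰v) h)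
  ...   | no h with 0ℤ <? u
  ...     | yes 0<u = inj₂ (C (neg-mono-< 0<u) (neg-mono-< (≰⇒> 0≰v))
                            (subst₂ _<_ (sym (neg-square u)) (sym (neg-square-D v)) (≰⇒> h)))
  ...     | no 0≮u = inj₂ (A (0≤-neg (≮⇒≥ 0≮u)) (0≤-neg (<⇒≤ (≰⇒> 0≰v)) , inj₂ (neg-mono-< (≰⇒> 0≰v))))
  nonNeg⊎negPos u v | no 0≰u | _ with 0ℤ <? v
  ... | no 0≮v = inj₂ (A (0≤-neg (<⇒≤ (≰⇒> 0≰u))) (0≤-neg (≮⇒≥ 0≮v) , inj₁ (neg-mono-< (≰⇒> 0≰u))))
  ... | yes 0<v with u * u ≤? v * v * D
  ...   | yes h = inj₁ (C (≰⇒> 0≰u) 0<v h)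
  ...   | no h = inj₂ (B (0≤-neg (<⇒≤ (≰⇒> 0≰u))) (neg-mono-< 0<v)
                        (subst₂ _<_ (sym (neg-square-D v)) (sym (neg-square u)) (≰⇒> h)))

  pos⇒nonNeg : PS u v → NNS u v
  pos⇒nonNeg (A 0≤u (0≤v , _)) = A 0≤u 0≤v
  pos⇒nonNeg (B 0≤u v<0 h) = B 0≤u v<0 (<⇒≤ h)
  pos⇒nonNeg (C u<0 0<v h) = C u<0 0<v (<⇒≤ h)

  pos⇒¬nonNegNeg : ∀ u v → PS u v → ¬ NNS (- u) (- v)
  pos⇒¬nonNegNeg u v p n = nonNeg⇒¬negPos n (subst₂ PS (sym (neg-involutive u)) (sym (neg-involutive v)) p)

  ¬nonNegNeg⇒pos : ∀ u v → ¬ NNS (- u) (- v) → PS u v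
  ¬nonNegNeg⇒pos u v h with nonNeg⊎negPos (- u) (- v)
  ... | inj₁ n = ⊥-elim (h n)
  ... | inj₂ p = subst₂ PS (neg-involutive u) (neg-involutive v) p

  -- (u + v√D)√D = vD + u√D
  nonNeg-*√D : NNS u v → NNS (v * D) u
  nonNeg-*√D (A 0≤u 0≤v) = A (0≤* 0≤v 0≤D) 0≤u
  nonNeg-*√D {u} {v} (B 0≤u v<0 h) =
    C (*-monoʳ-<-pos D {{positive 0<D}} v<0) 0<u
      (subst (_≤ u * u * D) (ring v D) (*-monoʳ-≤-nonNeg D {{nonNegative 0≤D}} h))
    where
    0<u : 0ℤ < u
    0<u = square-cancel-< 0≤u (<-≤-trans (0<* (0<square-neg v<0) 0<D) h)
    ring : ∀ v D → v * v * D * D ≡ v * D * (v * D)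
    ring = solve-∀
  nonNeg-*√D {u} {v} (C u<0 0<v h) =
    B (0≤* (<⇒≤ 0<v) 0≤D) u<0 (subst (u * u * D ≤_) (ring v D) (*-monoʳ-≤-nonNeg D {{nonNegative 0≤D}} h))
    where
    ring : ∀ v D → v * v * D * D ≡ v * D * (v * D)
    ring = solve-∀

  private
    scale-square : ∀ c x → c * x * (c * x) ≡ c * c * (x * x)
    scale-square = solve-∀
    scale-square-D : ∀ c x → c * x * (c * x) * D ≡ c * c * (x * x * D)
    scale-square-D c x = solve′ c x D
      where
      solve′ : ∀ c x D → c * x * (c * x) * D ≡ c * c * (x * x * D)
      solve′ = solve-∀
    square-scale-≤ : 0ℤ < c → ∀ {x y} → x ≤ y → c * c * x ≤ c * c * y
    square-scale-≤ {c} 0<c = *-monoˡ-≤-nonNeg (c * c) {{nonNegative (0≤square c)}}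
    square-unscale-≤ : 0ℤ < c → ∀ {x y} → c * c * x ≤ c * c * y → x ≤ y
    square-unscale-≤ {c} 0<c {x} {y} = *-cancelˡ-≤-pos x y (c * c) {{positive (0<* 0<c 0<c)}}
    *-neg : 0ℤ < c → i < 0ℤ → c * i < 0ℤ
    *-neg {c} {i} 0<c i<0 = subst (c * i <_) (*-zeroʳ c) (*-monoˡ-<-pos c {{positive 0<c}} i<0)
    cancel-0≤ : 0ℤ < c → 0ℤ ≤ c * i → 0ℤ ≤ i
    cancel-0≤ {c} {i} 0<c h = *-cancelˡ-≤-pos 0ℤ i c {{positive 0<c}} (subst (_≤ c * i) (sym (*-zeroʳ c)) h)
    cancel-0< : 0ℤ < c → 0ℤ < c * i → 0ℤ < i
    cancel-0< {c} {i} 0<c h =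
      *-cancelˡ-<-nonNeg c {{nonNegative (<⇒≤ 0<c)}} (subst (_< c * i) (sym (*-zeroʳ c)) h)
    cancel-<0 : 0ℤ < c → c * i < 0ℤ → i < 0ℤ
    cancel-<0 {c} {i} 0<c h =
      *-cancelˡ-<-nonNeg c {{nonNegative (<⇒≤ 0<c)}} (subst (c * i <_) (sym (*-zeroʳ c)) h)

  nonNeg-scale : 0ℤ < c → NNS u v → NNS (c * u) (c * v)
  nonNeg-scale 0<c (A 0≤u 0≤v) = A (0≤* (<⇒≤ 0<c) 0≤u) (0≤* (<⇒≤ 0<c) 0≤v)
  nonNeg-scale {c} {u} {v} 0<c (B 0≤u v<0 h) = B (0≤* (<⇒≤ 0<c) 0≤u) (*-neg 0<c v<0)
    (subst₂ _≤_ (sym (scale-square-D c v)) (sym (scale-square c u)) (square-scale-≤ 0<c h))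
  nonNeg-scale {c} {u} {v} 0<c (C u<0 0<v h) = C (*-neg 0<c u<0) (0<* 0<c 0<v)
    (subst₂ _≤_ (sym (scale-square c u)) (sym (scale-square-D c v)) (square-scale-≤ 0<c h))

  nonNeg-unscale : 0ℤ < c → NNS (c * u) (c * v) → NNS u v
  nonNeg-unscale 0<c (A 0≤cu 0≤cv) = A (cancel-0≤ 0<c 0≤cu) (cancel-0≤ 0<c 0≤cv)
  nonNeg-unscale {c} {u} {v} 0<c (B 0≤cu cv<0 h) = B (cancel-0≤ 0<c 0≤cu) (cancel-<0 0<c cv<0)
    (square-unscale-≤ 0<c (subst₂ _≤_ (scale-square-D c v) (scale-square c u) h))
  nonNeg-unscale {c} {u} {v} 0<c (C cu<0 0<cv h) = C (cancel-<0 0<c cu<0) (cancel-0< 0<c 0<cv)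
    (square-unscale-≤ 0<c (subst₂ _≤_ (scale-square c u) (scale-square-D c v) h))

  pos-+ : PS u₁ v₁ → NNS u₂ v₂ → PS (u₁ + u₂) (v₁ + v₂)
  pos-+ {u₁} {v₁} {u₂} {v₂} p n = ¬nonNegNeg⇒pos (u₁ + u₂) (v₁ + v₂) λ h →
    pos⇒¬nonNegNeg u₁ v₁ p (subst₂ NNS (cancel u₁ u₂) (cancel v₁ v₂) (nonNeg-+ h n))
    where
    cancel : ∀ a b → - (a + b) + b ≡ - a
    cancel = solve-∀

  pos-scale : 0ℤ < c → PS u v → PS (c * u) (c * v)
  pos-scale {c} {u} {v} 0<c p = ¬nonNegNeg⇒pos (c * u) (c * v) λ h →
    pos⇒¬nonNegNeg u v p (nonNeg-unscale 0<c (subst₂ NNS (neg-distribʳ-* c u) (neg-distribʳ-* c v) h))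

  pos-unscale : 0ℤ < c → PS (c * u) (c * v) → PS u v
  pos-unscale {c} {u} {v} 0<c p = ¬nonNegNeg⇒pos u v λ h → pos⇒¬nonNegNeg (c * u) (c * v) p
    (subst₂ NNS (sym (neg-distribʳ-* c u)) (sym (neg-distribʳ-* c v)) (nonNeg-scale 0<c h))

module ZβOrder (m : ℕ.ℕ) (3≤m : 3 ℕ.≤ m) where
  open import Data.Nat.Base using (z≤n; s≤s)
  open import Data.Integer.Base
  open import Data.Integer.Properties hiding (pos-+)
  open import Data.Integer.Tactic.RingSolver using (solve-∀)
  open import Data.Empty using (⊥-elim)
  open import Data.Product using (_,_; proj₁; proj₂)
  open import Data.Sum using (_⊎_; inj₁; inj₂)
  open import Relation.Binary.PropositionalEquality
  open import Relation.Nullary using (¬_)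
  open IntegerOrder

  M : ℤ
  M = + m

  3≤M : + 3 ≤ M
  3≤M = +≤+ 3≤m

  0<2 : 0ℤ < + 2
  0<2 = +<+ (s≤s z≤n)

  0<M : 0ℤ < M
  0<M = <-≤-trans (+<+ (s≤s z≤n)) 3≤M

  0<disc : 0ℤ < disc m
  0<disc = <-by _ (0≤+ (0≤+ (0≤square (M - + 3)) (0≤* (0≤ℕ 6) 0≤M-3)) (0≤ℕ 4)) (ring M)
    where
    0≤M-3 = i≤j⇒0≤j-i 3≤M
    ring : ∀ M → M * M - + 4 ≡ (1ℤ + 0ℤ) + ((M - + 3) * (M - + 3) + + 6 * (M - + 3) + + 4)
    ring = solve-∀

  module S = SurdOrder (disc m) 0<disc

  private variable x y z : Zβ

  infixl 6 _+β_

  _+β_ : Zβ → Zβ → Zβ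
  x +β y = (re x + re y) ⊕ (co x + co y) β

  negβ : Zβ → Zβ
  negβ x = (- re x) ⊕ (- co x) β

  -- multiplication by β⁻¹ = m − β
  β⁻¹times : Zβ → Zβ
  β⁻¹times x = (re x * M + co x) ⊕ (- re x) β

  1−β⁻¹ : Zβ
  1−β⁻¹ = (1ℤ - M) ⊕ 1ℤ β

  Zβ-≡ : re x ≡ re y → co x ≡ co y → x ≡ y
  Zβ-≡ {_ ⊕ _ β} {_ ⊕ _ β} refl refl = refl

  private
    uOf-+ : ∀ M a b c d → + 2 * a + b * M + (+ 2 * c + d * M) ≡ + 2 * (a + c) + (b + d) * M
    uOf-+ = solve-∀
    uOf-neg : ∀ M a b → + 2 * (- a) + (- b) * M ≡ - (+ 2 * a + b * M)
    uOf-neg = solve-∀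
    uOf-β : ∀ M a b → M * (+ 2 * a + b * M) + b * (M * M - + 4) ≡ + 2 * (+ 2 * (- b) + (a + M * b) * M)
    uOf-β = solve-∀
    co-β : ∀ M a b → M * b + (+ 2 * a + b * M) ≡ + 2 * (a + M * b)
    co-β = solve-∀

  nonNeg-+β : NonNeg m x → NonNeg m y → NonNeg m (x +β y)
  nonNeg-+β {x} {y} p q =
    subst (λ u → S.NNS u (co x + co y)) (uOf-+ M (re x) (co x) (re y) (co y)) (S.nonNeg-+ p q)

  pos-+β : Pos m x → NonNeg m y → Pos m (x +β y)
  pos-+β {x} {y} p q =
    subst (λ u → S.PS u (co x + co y)) (uOf-+ M (re x) (co x) (re y) (co y)) (S.pos-+ p q)

  -- β = (M + √D)/2, so 2β(u + v√D) = M(u + v√D) + (u + v√D)√D in the coordinates (uOf, co).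
  nonNeg-β : NonNeg m x → NonNeg m (βtimes m x)
  nonNeg-β {x} p = S.nonNeg-unscale 0<2 (subst₂ S.NNS (uOf-β M (re x) (co x)) (co-β M (re x) (co x))
    (S.nonNeg-+ (S.nonNeg-scale 0<M p) (S.nonNeg-*√D p)))

  pos-β : Pos m x → Pos m (βtimes m x)
  pos-β {x} p = S.pos-unscale 0<2 (subst₂ S.PS (uOf-β M (re x) (co x)) (co-β M (re x) (co x))
    (S.pos-+ (S.pos-scale 0<M p) (S.nonNeg-*√D (S.pos⇒nonNeg p))))

  nonNeg⊎negPos : ∀ x → NonNeg m x ⊎ Pos m (negβ x)
  nonNeg⊎negPos x with S.nonNeg⊎negPos (uOf m x) (co x)
  ... | inj₁ n = inj₁ n
  ... | inj₂ p = inj₂ (subst (λ u → S.PS u (- co x)) (sym (uOf-neg M (re x) (co x))) p)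

  nonNeg⇒¬negPos : NonNeg m x → ¬ Pos m (negβ x)
  nonNeg⇒¬negPos {x} n p =
    S.nonNeg⇒¬negPos n (subst (λ u → S.PS u (- co x)) (uOf-neg M (re x) (co x)) p)

  β-β⁻¹ : ∀ x → βtimes m (β⁻¹times x) ≡ x
  β-β⁻¹ x = Zβ-≡ (neg-involutive (re x)) (cancel M (re x) (co x))
    where
    cancel : ∀ M a b → a * M + b + M * (- a) ≡ b
    cancel = solve-∀

  negβ-involutive : ∀ x → negβ (negβ x) ≡ x
  negβ-involutive x = Zβ-≡ (neg-involutive (re x)) (neg-involutive (co x))

  β-negβ-β⁻¹ : ∀ x → βtimes m (negβ (β⁻¹times x)) ≡ negβ x
  β-negβ-β⁻¹ x = Zβ-≡ (cong -_ (neg-involutive (re x))) (ring M (re x) (co x))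
    where
    ring : ∀ M a b → - (a * M + b) + M * - (- a) ≡ - b
    ring = solve-∀

  nonNeg-β⁻¹ : NonNeg m x → NonNeg m (β⁻¹times x)
  nonNeg-β⁻¹ {x} n with nonNeg⊎negPos (β⁻¹times x)
  ... | inj₁ n′ = n′
  ... | inj₂ p = ⊥-elim (nonNeg⇒¬negPos {x} n
                   (subst (Pos m) (β-negβ-β⁻¹ x) (pos-β {negβ (β⁻¹times x)} p)))

  pos-β⁻¹ : Pos m x → Pos m (β⁻¹times x)
  pos-β⁻¹ {x} p with nonNeg⊎negPos (negβ (β⁻¹times x))
  ... | inj₁ n = ⊥-elim (nonNeg⇒¬negPos {negβ x}
                   (subst (NonNeg m) (β-negβ-β⁻¹ x) (nonNeg-β {negβ (β⁻¹times x)} n))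
                   (subst (Pos m) (sym (negβ-involutive x)) p))
  ... | inj₂ p′ = subst (Pos m) (negβ-involutive (β⁻¹times x)) p′

  ι+β⇒−βι : ∀ {y k g} → y ≡ ι k +β g → g ≡ y −β ι k
  ι+β⇒−βι {k = k} {g} refl = Zβ-≡ (ring k (re g)) (ring (+ 0) (co g))
    where
    ring : ∀ k r → r ≡ k + r - k
    ring = solve-∀

  nonNeg-ι : ∀ {k} → 0ℤ ≤ k → NonNeg m (ι k)
  nonNeg-ι 0≤k = inj₁ (0≤+ (0≤* (0≤ℕ 2) 0≤k) (0≤ℕ 0) , 0≤ℕ 0)

  pos-ι⁻¹ : ∀ k → Pos m (ι k) → 0ℤ < k
  pos-ι⁻¹ k (inj₁ (_ , _ , inj₁ 0<2k)) =
    *-cancelˡ-<-nonNeg (+ 2) (subst (0ℤ <_) (+-identityʳ (+ 2 * k)) 0<2k)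
  pos-ι⁻¹ k (inj₁ (_ , _ , inj₂ (+<+ ())))
  pos-ι⁻¹ k (inj₂ (inj₁ (_ , +<+ () , _)))
  pos-ι⁻¹ k (inj₂ (inj₂ (_ , +<+ () , _)))

  -- 1 − β⁻¹ = β − (m − 1) has u-coordinate 2 − m < 0 and (2 − m)² < m² − 4.
  pos-1−β⁻¹ : Pos m 1−β⁻¹
  pos-1−β⁻¹ = inj₂ (inj₂ (<-by _ 0≤M-3 (u<0 M) , +<+ (s≤s z≤n) ,
                           <-by _ (0≤+ (0≤* (0≤ℕ 4) 0≤M-3) (0≤ℕ 3)) (u²<D M)))
    where
    0≤M-3 = i≤j⇒0≤j-i 3≤M
    u<0 : ∀ M → 0ℤ ≡ 1ℤ + (+ 2 * (1ℤ - M) + 1ℤ * M) + (M - + 3)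
    u<0 = solve-∀
    u²<D : ∀ M → 1ℤ * 1ℤ * (M * M - + 4) ≡
           1ℤ + (+ 2 * (1ℤ - M) + 1ℤ * M) * (+ 2 * (1ℤ - M) + 1ℤ * M) + (+ 4 * (M - + 3) + + 3)
    u²<D = solve-∀

  ≤-<-trans-β : x ≤[ m ] y → y <[ m ] z → x <[ m ] z
  ≤-<-trans-β {x} {y} {z} x≤y y<z =
    subst (Pos m) (Zβ-≡ (ring (re x) (re y) (re z)) (ring (co x) (co y) (co z)))
      (pos-+β {z −β y} {y −β x} y<z x≤y)
    where
    ring : ∀ a b c → c - b + (b - a) ≡ c - a
    ring = solve-∀

  isFloor : ∀ y k → NonNeg m (y −β ι k) → Pos m (ι 1ℤ −β (y −β ι k)) → IsFloor m y k
  isFloor y k n p = n , subst (Pos m) (Zβ-≡ (ring₁ k (re y)) (ring₂ (co y))) p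
    where
    ring₁ : ∀ k r → 1ℤ - (r - k) ≡ k + 1ℤ - r
    ring₁ = solve-∀
    ring₂ : ∀ c → 0ℤ - (c - 0ℤ) ≡ 0ℤ - c
    ring₂ = solve-∀

  floor-unique : ∀ {y k j} → IsFloor m y k → IsFloor m y j → k ≡ j
  floor-unique {y} (k≤y , y<k+1) (j≤y , y<j+1) = ≤-antisym (below k≤y y<j+1) (below j≤y y<k+1)
    where
    below : ∀ {a b} → ι a ≤[ m ] y → y <[ m ] ι (b + 1ℤ) → a ≤ b
    below {a} {b} a≤y y<b+1 =
      0<j+1-i⇒i≤j (pos-ι⁻¹ (b + 1ℤ - a) (≤-<-trans-β {ι a} {y} {ι (b + 1ℤ)} a≤y y<b+1))

  betaExp-unique : ∀ {x d d′} → IsBetaExp m x d → IsBetaExp m x d′ → ∀ i → d i ≡ d′ i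
  betaExp-unique {x} {d} {d′} (t , t₀ , step) (t′ , t′₀ , step′) = same-digit
    where
    same-orbit : ∀ i → t i ≡ t′ i
    same-digit : ∀ i → d i ≡ d′ i
    same-orbit ℕ.zero = trans t₀ (sym t′₀)
    same-orbit (ℕ.suc i) = begin
      t (ℕ.suc i)                  ≡⟨ proj₂ (step i) ⟩
      βtimes m (t i) −β ι (d i)     ≡⟨ cong₂ (λ s k → βtimes m s −β ι k) (same-orbit i) (same-digit i) ⟩
      βtimes m (t′ i) −β ι (d′ i)   ≡⟨ sym (proj₂ (step′ i)) ⟩
      t′ (ℕ.suc i)                 ∎
      where open ≡-Reasoning
    same-digit i = floor-unique {βtimes m (t i)} (proj₁ (step i))
      (subst (λ s → IsFloor m (βtimes m s) (d′ i)) (sym (same-orbit i)) (proj₁ (step′ i)))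

module USequence (m : ℕ.ℕ) (3≤m : 3 ℕ.≤ m) where
  open import Data.Nat.Base
  open import Data.Nat.Properties
  open import Data.Nat.Tactic.RingSolver using (solve-∀)
  open import Data.Empty using (⊥-elim)
  open import Data.List.Base using (List; []; _∷_; _++_; [_]; take; drop; length)
  open import Data.List.Properties using (length-take)
  open import Data.Product using (Σ; _×_; _,_; proj₁; proj₂)
  open import Data.Sum using (_⊎_; inj₁; inj₂)
  open import Relation.Binary.PropositionalEquality using (_≡_; _≢_; refl; sym; trans; cong; subst; subst₂)
  open import Relation.Nullary using (yes; no)
  open import Function.Base using (_∘′_)
  open ≤-Reasoning

  1≤m : 1 ≤ m
  1≤m = ≤-trans (s≤s z≤n) 3≤m

  -- U is increasing, so the truncated subtraction in its definition is exact; the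
  -- two facts are proved together.
  U-mono×rec : ∀ q → U m q ≤ U m (suc q) × U m (2 + q) + U m q ≡ m * U m (1 + q)
  U-mono×rec zero = 1≤m , m∸n+n≡m (≤-trans 1≤m (m≤m*n m m {{>-nonZero 1≤m}}))
  U-mono×rec (suc q) = mono , m∸n+n≡m (≤-trans mono (m≤n*m (U m (2 + q)) m {{>-nonZero 1≤m}}))
    where
    mono : U m (1 + q) ≤ U m (2 + q)
    mono = +-cancelʳ-≤ (U m q) _ _ (begin
      U m (1 + q) + U m q       ≤⟨ +-monoʳ-≤ (U m (1 + q)) (proj₁ (U-mono×rec q)) ⟩
      U m (1 + q) + U m (1 + q) ≡⟨ cong (U m (1 + q) +_) (+-identityʳ (U m (1 + q))) ⟨
      2 * U m (1 + q)           ≤⟨ *-monoˡ-≤ (U m (1 + q)) (≤-trans (s≤s (s≤s z≤n)) 3≤m) ⟩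
      m * U m (1 + q)           ≡⟨ proj₂ (U-mono×rec q) ⟨
      U m (2 + q) + U m q       ∎)

  U-mono : ∀ q → U m q ≤ U m (suc q)
  U-mono q = proj₁ (U-mono×rec q)

  U-rec : ∀ q → U m (2 + q) + U m q ≡ m * U m (1 + q)
  U-rec q = proj₂ (U-mono×rec q)

  U-pos : ∀ q → 1 ≤ U m q
  U-pos zero = s≤s z≤n
  U-pos (suc q) = ≤-trans (U-pos q) (U-mono q)

  U-suc≤ : ∀ q → U m (suc q) ≤ m * U m q
  U-suc≤ zero = m≤m*n m 1
  U-suc≤ (suc q) = m∸n≤m (m * U m (suc q)) (U m q)

  U-dOcagne : ∀ o d → U m (1 + o) * U m (1 + o + d) ≡ U m o * U m (2 + o + d) + U m d
  U-dOcagne zero d = trans (sym (U-rec d)) (cong (_+ U m d) (sym (+-identityʳ (U m (2 + d)))))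
  U-dOcagne (suc o) d = +-cancelʳ-≡ (C * Y) (A * Y) (B * X + U m d) (begin-equality
      A * Y + C * Y          ≡⟨ *-distribʳ-+ Y A C ⟨
      (A + C) * Y            ≡⟨ cong (_* Y) (U-rec o) ⟩
      m * B * Y              ≡⟨ regroup m B Y ⟩
      B * (m * Y)            ≡⟨ cong (B *_) (U-rec (1 + o + d)) ⟨
      B * (X + Z)            ≡⟨ *-distribˡ-+ B X Z ⟩
      B * X + B * Z          ≡⟨ cong (B * X +_) (U-dOcagne o d) ⟩
      B * X + (C * Y + U m d) ≡⟨ swap-last (B * X) (C * Y) (U m d) ⟩
      B * X + U m d + C * Y  ∎)
    where
    A = U m (2 + o)
    B = U m (1 + o)
    C = U m o
    X = U m (3 + o + d)
    Y = U m (2 + o + d)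
    Z = U m (1 + o + d)
    regroup : ∀ m B Y → m * B * Y ≡ B * (m * Y)
    regroup = solve-∀
    swap-last : ∀ a b c → a + (b + c) ≡ a + c + b
    swap-last = solve-∀

  U-ratio-mono : ∀ {o i} → o ≤ i → U m o * U m (2 + i) ≤ U m (1 + o) * U m (1 + i)
  U-ratio-mono {o} {i} o≤i with i ∸ o | m+[n∸m]≡n o≤i
  ... | d | refl = subst (U m o * U m (2 + o + d) ≤_) (sym (U-dOcagne o d)) (m≤m+n _ _)

  valueFrom-ratio : ∀ i bs o → o + length bs ≤ suc i →
                    valueFrom m bs o * U m (2 + i) ≤ valueFrom m bs (suc o) * U m (1 + i)
  valueFrom-ratio i [] o _ = z≤n
  valueFrom-ratio i (b ∷ bs) o h = begin
    (b * U m o + valueFrom m bs (1 + o)) * U m (2 + i)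
      ≡⟨ *-distribʳ-+ (U m (2 + i)) (b * U m o) _ ⟩
    b * U m o * U m (2 + i) + valueFrom m bs (1 + o) * U m (2 + i)
      ≤⟨ +-mono-≤ leading (valueFrom-ratio i bs (suc o) h′) ⟩
    b * U m (1 + o) * U m (1 + i) + valueFrom m bs (2 + o) * U m (1 + i)
      ≡⟨ *-distribʳ-+ (U m (1 + i)) (b * U m (1 + o)) _ ⟨
    (b * U m (1 + o) + valueFrom m bs (2 + o)) * U m (1 + i) ∎
    where
    h′ : suc o + length bs ≤ suc i
    h′ = subst (_≤ suc i) (+-suc o (length bs)) h
    leading : b * U m o * U m (2 + i) ≤ b * U m (1 + o) * U m (1 + i)
    leading = subst₂ _≤_ (sym (*-assoc b _ _)) (sym (*-assoc b _ _))
      (*-monoʳ-≤ b (U-ratio-mono (m+n≤o⇒m≤o o (s≤s⁻¹ h′))))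

  -- The greedy inequalities for digits placed from position o on, above a prefix sum s.
  record Greedy (as : List ℕ) (o s : ℕ) : Set where
    constructor greedy
    field bound : ∀ i → i < length as → s + valueFrom m (take (suc i) as) o < U m (suc (o + i))
  open Greedy

  greedy-head : ∀ {a as o s} → Greedy (a ∷ as) o s → s + a * U m o < U m (suc o)
  greedy-head {a} {as} {o} {s} g =
    subst₂ _<_ (cong (s +_) (+-identityʳ (a * U m o))) (cong (λ k → U m (suc k)) (+-identityʳ o))
      (bound g 0 (s≤s z≤n))

  greedy-tail : ∀ {a as o s} → Greedy (a ∷ as) o s → Greedy as (suc o) (s + a * U m o)
  greedy-tail {a} {as} {o} {s} g = greedy λ i i<len →
    subst₂ _<_ (sym (+-assoc s _ _)) (cong (λ k → U m (suc k)) (+-suc o i)) (bound g (suc i) (s≤s i<len))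

  greedy-digit<m : ∀ {a as o s} → Greedy (a ∷ as) o s → a < m
  greedy-digit<m {a} {as} {o} {s} g =
    *-cancelʳ-< (U m o) a m (≤-<-trans (m≤n+m (a * U m o) s) (<-≤-trans (greedy-head g) (U-suc≤ o)))

  -- Since U_o/U_{o+1} ≤ U_{i+1}/U_{i+2} for o ≤ i, the i-th greedy inequality for as
  -- follows from the (i+1)-th one for a ∷ as.
  greedy-drop : ∀ ds → Greedy ds 0 0 → Greedy (drop 1 ds) 0 0
  greedy-drop [] g = greedy λ _ ()
  greedy-drop (a ∷ as) g = greedy bound′
    where
    bound′ : ∀ i → i < length as → valueFrom m (take (suc i) as) 0 < U m (1 + i)
    bound′ i i<len = *-cancelʳ-< (U m (2 + i)) _ _ (begin-strict
      valueFrom m bs 0 * U m (2 + i)  ≤⟨ valueFrom-ratio i bs 0 length-bs ⟩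
      valueFrom m bs 1 * U m (1 + i)  <⟨ *-monoˡ-< (U m (1 + i)) {{>-nonZero (U-pos (1 + i))}} tail-bound ⟩
      U m (2 + i) * U m (1 + i)       ≡⟨ *-comm (U m (2 + i)) (U m (1 + i)) ⟩
      U m (1 + i) * U m (2 + i)       ∎)
      where
      bs = take (suc i) as
      length-bs : length bs ≤ suc i
      length-bs = subst (_≤ suc i) (sym (length-take (suc i) as)) (m⊓n≤m (suc i) (length as))
      tail-bound : valueFrom m bs 1 < U m (2 + i)
      tail-bound = ≤-<-trans (m≤n+m (valueFrom m bs 1) (a * 1)) (bound g (suc i) (s≤s i<len))

  digit-cases : ∀ b → 3 + b ≤ m ⊎ 2 + b ≡ m ⊎ 1 + b ≡ m ⊎ m ≤ b
  digit-cases b with 3 + b ≤? m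
  ... | yes h = inj₁ h
  ... | no h with 2 + b ≟ m
  ...   | yes e = inj₂ (inj₁ e)
  ...   | no e with 1 + b ≟ m
  ...     | yes e′ = inj₂ (inj₂ (inj₁ e′))
  ...     | no e′ = inj₂ (inj₂ (inj₂ m≤b))
    where
    m≤2+b = s≤s⁻¹ (≰⇒> h)
    m≤1+b = s≤s⁻¹ (≤∧≢⇒< m≤2+b (e ∘′ sym))
    m≤b = s≤s⁻¹ (≤∧≢⇒< m≤1+b (e′ ∘′ sym))

  -- as·0^ω is lexicographically below (m−2)^ω, the tail of the quasi-greedy expansion
  -- (m−1)(m−2)^ω of 1 in base β.
  data LexBelowTail : List ℕ → Set where
    done    : LexBelowTail []
    smaller : ∀ {a as} → 3 + a ≤ m → LexBelowTail (a ∷ as)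
    same    : ∀ {a as} → 2 + a ≡ m → LexBelowTail as → LexBelowTail (a ∷ as)

  data Admissible : List ℕ → Set where
    done  : Admissible []
    small : ∀ {a as} → 2 + a ≤ m → Admissible as → Admissible (a ∷ as)
    top   : ∀ {a as} → 1 + a ≡ m → LexBelowTail as → Admissible as → Admissible (a ∷ as)

  admissible-drop : ∀ i {ds} → Admissible ds → Admissible (drop i ds)
  admissible-drop zero adm = adm
  admissible-drop (suc i) done = done
  admissible-drop (suc i) (small _ adm) = admissible-drop i adm
  admissible-drop (suc i) (top _ _ adm) = admissible-drop i adm

  -- A prefix sum s ≥ U_{q+1} − U_q leaves room only for digits lexicographically below
  -- (m − 2)^ω from position q + 1 on.
  greedy⇒lexBelowTail : ∀ bs q s → U m (suc q) ≤ s + U m q → Greedy bs (suc q) s → LexBelowTail bs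
  greedy⇒lexBelowTail [] q s _ _ = done
  greedy⇒lexBelowTail (b ∷ bs) q s room g with digit-cases b
  ... | inj₁ 3+b≤m = smaller 3+b≤m
  ... | inj₂ (inj₁ 2+b≡m) =
    same 2+b≡m (greedy⇒lexBelowTail bs (suc q) (s + b * U m (1 + q)) room′ (greedy-tail g))
    where
    ring₁ : ∀ b U₁ → (2 + b) * U₁ ≡ b * U₁ + U₁ + U₁
    ring₁ = solve-∀
    ring₂ : ∀ s b U₀ U₁ → b * U₁ + U₁ + (s + U₀) ≡ s + b * U₁ + U₁ + U₀
    ring₂ = solve-∀
    room′ : U m (2 + q) ≤ s + b * U m (1 + q) + U m (1 + q)
    room′ = +-cancelʳ-≤ (U m q) _ _ (begin
      U m (2 + q) + U m q                          ≡⟨ U-rec q ⟩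
      m * U m (1 + q)                              ≡⟨ cong (_* U m (1 + q)) 2+b≡m ⟨
      (2 + b) * U m (1 + q)                        ≡⟨ ring₁ b (U m (1 + q)) ⟩
      b * U m (1 + q) + U m (1 + q) + U m (1 + q)  ≤⟨ +-monoʳ-≤ (b * U m (1 + q) + U m (1 + q)) room ⟩
      b * U m (1 + q) + U m (1 + q) + (s + U m q)  ≡⟨ ring₂ s b (U m q) (U m (1 + q)) ⟩
      s + b * U m (1 + q) + U m (1 + q) + U m q    ∎)
  ... | inj₂ (inj₂ (inj₁ 1+b≡m)) = ⊥-elim (<⇒≱ (greedy-head g) too-big)
    where
    ring : ∀ s b U₀ U₁ → s + U₀ + b * U₁ ≡ s + b * U₁ + U₀
    ring = solve-∀
    too-big : U m (2 + q) ≤ s + b * U m (1 + q)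
    too-big = +-cancelʳ-≤ (U m q) _ _ (begin
      U m (2 + q) + U m q              ≡⟨ U-rec q ⟩
      m * U m (1 + q)                  ≡⟨ cong (_* U m (1 + q)) 1+b≡m ⟨
      U m (1 + q) + b * U m (1 + q)    ≤⟨ +-monoˡ-≤ (b * U m (1 + q)) room ⟩
      s + U m q + b * U m (1 + q)      ≡⟨ ring s b (U m q) (U m (1 + q)) ⟩
      s + b * U m (1 + q) + U m q      ∎)
  ... | inj₂ (inj₂ (inj₂ m≤b)) = ⊥-elim (<⇒≱ (greedy-digit<m g) m≤b)

  greedy⇒admissible : ∀ as o s → Greedy as o s → Admissible as
  greedy⇒admissible [] _ _ _ = done
  greedy⇒admissible (a ∷ as) o s g = by-digit (digit-cases a)
    where
    rest : Admissible as
    rest = greedy⇒admissible as (suc o) _ (greedy-tail g)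
    by-digit : 3 + a ≤ m ⊎ 2 + a ≡ m ⊎ 1 + a ≡ m ⊎ m ≤ a → Admissible (a ∷ as)
    by-digit (inj₁ 3+a≤m) = small (≤-trans (n≤1+n (2 + a)) 3+a≤m) rest
    by-digit (inj₂ (inj₁ 2+a≡m)) = small (≤-reflexive 2+a≡m) rest
    by-digit (inj₂ (inj₂ (inj₁ 1+a≡m))) = top 1+a≡m (greedy⇒lexBelowTail as o (s + a * U m o) room (greedy-tail g)) rest
      where
      room : U m (1 + o) ≤ s + a * U m o + U m o
      room = begin
        U m (1 + o)              ≤⟨ U-suc≤ o ⟩
        m * U m o                ≡⟨ cong (_* U m o) 1+a≡m ⟨
        U m o + a * U m o        ≤⟨ +-monoʳ-≤ (U m o) (m≤n+m (a * U m o) s) ⟩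
        U m o + (s + a * U m o)  ≡⟨ +-comm (U m o) _ ⟩
        s + a * U m o + U m o    ∎
    by-digit (inj₂ (inj₂ (inj₂ m≤a))) = ⊥-elim (<⇒≱ (greedy-digit<m g) m≤a)

  uExp-drop : ∀ {n ds} → UExp m n ds → UExp m (value m (drop 1 ds)) (drop 1 ds)
  uExp-drop {ds = ds} e = record
    { sums = refl
    ; leading = leading-drop ds (UExp.leading e)
    ; greedy = bound (greedy-drop ds (greedy (UExp.greedy e)))
    }
    where
    leading-drop : ∀ ds → ds ≡ [] ⊎ Σ (List ℕ) (λ ds′ → Σ ℕ (λ a → ds ≡ ds′ ++ [ a ] × a ≢ 0)) →
      drop 1 ds ≡ [] ⊎ Σ (List ℕ) (λ ds′ → Σ ℕ (λ a → drop 1 ds ≡ ds′ ++ [ a ] × a ≢ 0))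
    leading-drop _ (inj₁ refl) = inj₁ refl
    leading-drop _ (inj₂ ([] , a , refl , a≢0)) = inj₁ refl
    leading-drop _ (inj₂ (_ ∷ ds′ , a , refl , a≢0)) = inj₂ (ds′ , a , refl , a≢0)

module BetaFraction (m : ℕ.ℕ) (3≤m : 3 ℕ.≤ m) where
  import Data.Nat.Base as ℕ
  import Data.Nat.Properties as ℕP
  open import Data.Nat.Base using (ℕ; zero; suc)
  open import Data.Integer.Base hiding (suc)
  open import Data.Integer.Properties hiding (pos-+)
  import Data.Integer.Properties as ℤP
  open import Data.Integer.Tactic.RingSolver using (solve-∀)
  open import Data.Empty using (⊥-elim)
  open import Data.List.Base using (List; []; _∷_; drop)
  open import Data.Product using (_,_)
  open import Data.Sum using (inj₁)
  open import Relation.Binary.PropositionalEquality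
  open IntegerOrder
  open ZβOrder m 3≤m
  open USequence m 3≤m using (Admissible; LexBelowTail; done; small; top; smaller; same; U-rec; admissible-drop)

  valueβ : List ℕ → Zβ
  valueβ [] = ι 0ℤ
  valueβ (a ∷ as) = β⁻¹times (ι (+ a) +β valueβ as)

  valueβ-nonNeg : ∀ as → NonNeg m (valueβ as)
  valueβ-nonNeg [] = nonNeg-ι ≤-refl
  valueβ-nonNeg (a ∷ as) = nonNeg-β⁻¹ {ι (+ a) +β valueβ as}
    (nonNeg-+β {ι (+ a)} {valueβ as} (nonNeg-ι (0≤ℕ a)) (valueβ-nonNeg as))

  sub-β⁻¹times : ∀ c y → c −β β⁻¹times y ≡ β⁻¹times (βtimes m c −β y)
  sub-β⁻¹times c y = Zβ-≡ (ring M (re c) (co c) (re y) (co y)) (ring′ (re c) (co c) (re y) (co y))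
    where
    ring : ∀ M a b r s → a - (r * M + s) ≡ (- b - r) * M + (a + M * b - s)
    ring = solve-∀
    ring′ : ∀ a b r s → b - (- r) ≡ - (- b - r)
    ring′ = solve-∀

  pos-sub-β⁻¹times : ∀ c y → Pos m (βtimes m c −β y) → Pos m (c −β β⁻¹times y)
  pos-sub-β⁻¹times c y p = subst (Pos m) (sym (sub-β⁻¹times c y)) (pos-β⁻¹ {βtimes m c −β y} p)

  -- β − k − G = (1 − β⁻¹) + (m − 2 − k) + (1 − G), using β + β⁻¹ = m.
  β-digit-room : ∀ k G → + 2 + k ≤ M → Pos m (ι 1ℤ −β G) → Pos m (βtimes m (ι 1ℤ) −β (ι k +β G))
  β-digit-room k G 2+k≤M G<1 = subst (Pos m) (Zβ-≡ (ring M k (re G)) (ring′ M (co G)))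
    (pos-+β {1−β⁻¹} {ι (M - (+ 2 + k)) +β (ι 1ℤ −β G)} pos-1−β⁻¹
      (nonNeg-+β {ι (M - (+ 2 + k))} {ι 1ℤ −β G} (nonNeg-ι (i≤j⇒0≤j-i 2+k≤M)) (S.pos⇒nonNeg G<1)))
    where
    ring : ∀ M k r → 1ℤ - M + (M - (+ 2 + k) + (1ℤ - r)) ≡ - 0ℤ - (k + r)
    ring = solve-∀
    ring′ : ∀ M c → 1ℤ + (0ℤ + (0ℤ - c)) ≡ 1ℤ + M * 0ℤ - (0ℤ + c)
    ring′ = solve-∀

  -- For k = m − 1:  β − k − G = (1 − β⁻¹) − G.
  β-digit-room-top : ∀ k G → + 1 + k ≡ M → Pos m (1−β⁻¹ −β G) → Pos m (βtimes m (ι 1ℤ) −β (ι k +β G))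
  β-digit-room-top k G 1+k≡M = subst (Pos m) (Zβ-≡ (ring k (re G) M 1+k≡M) (ring′ M (co G)))
    where
    ring : ∀ k r M → + 1 + k ≡ M → 1ℤ - M - r ≡ - 0ℤ - (k + r)
    ring k r M refl = solve′ k r
      where
      solve′ : ∀ k r → 1ℤ - (+ 1 + k) - r ≡ - 0ℤ - (k + r)
      solve′ = solve-∀
    ring′ : ∀ M c → 1ℤ - c ≡ 1ℤ + M * 0ℤ - (0ℤ + c)
    ring′ = solve-∀

  -- β(1 − β⁻¹) = β − 1
  pos-sub-β⁻¹times-1−β⁻¹ : ∀ k G → Pos m (βtimes m (ι 1ℤ) −β (ι (1ℤ + k) +β G)) →
                           Pos m (1−β⁻¹ −β β⁻¹times (ι k +β G))
  pos-sub-β⁻¹times-1−β⁻¹ k G p =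
    pos-sub-β⁻¹times 1−β⁻¹ (ι k +β G) (subst (Pos m) (Zβ-≡ (ring k (re G)) (ring′ M (co G))) p)
    where
    ring : ∀ k r → - 0ℤ - (1ℤ + k + r) ≡ - 1ℤ - (k + r)
    ring = solve-∀
    ring′ : ∀ M c → 1ℤ + M * 0ℤ - (0ℤ + c) ≡ 1ℤ - M + M * 1ℤ - (0ℤ + c)
    ring′ = solve-∀

  valueβ<1 : ∀ {as} → Admissible as → Pos m (ι 1ℤ −β valueβ as)
  valueβ<1−β⁻¹ : ∀ {as} → Admissible as → LexBelowTail as → Pos m (1−β⁻¹ −β valueβ as)

  valueβ<1 done = inj₁ (0≤ℕ 2 , ≤-refl , inj₁ (+<+ (ℕ.s≤s ℕ.z≤n)))
  valueβ<1 {a ∷ as} (small 2+a≤m adm) = pos-sub-β⁻¹times (ι 1ℤ) (ι (+ a) +β valueβ as)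
    (β-digit-room (+ a) (valueβ as) (+≤+ 2+a≤m) (valueβ<1 adm))
  valueβ<1 {a ∷ as} (top 1+a≡m lex adm) = pos-sub-β⁻¹times (ι 1ℤ) (ι (+ a) +β valueβ as)
    (β-digit-room-top (+ a) (valueβ as) (cong +_ 1+a≡m) (valueβ<1−β⁻¹ adm lex))

  valueβ<1−β⁻¹ done done = subst (Pos m) (Zβ-≡ (sym (+-identityʳ (1ℤ - M))) refl) pos-1−β⁻¹
  valueβ<1−β⁻¹ {a ∷ as} (small _ adm) (smaller 3+a≤m) = pos-sub-β⁻¹times-1−β⁻¹ (+ a) (valueβ as)
    (β-digit-room (1ℤ + + a) (valueβ as) (+≤+ 3+a≤m) (valueβ<1 adm))
  valueβ<1−β⁻¹ {a ∷ as} (small _ adm) (same 2+a≡m lex) = pos-sub-β⁻¹times-1−β⁻¹ (+ a) (valueβ as)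
    (β-digit-room-top (1ℤ + + a) (valueβ as) (cong +_ 2+a≡m) (valueβ<1−β⁻¹ adm lex))
  valueβ<1−β⁻¹ {a ∷ as} (top 1+a≡m _ _) (smaller 3+a≤m) =
    ⊥-elim (ℕP.1+n≰n (ℕP.≤-trans (ℕ.s≤s⁻¹ (subst (3 ℕ.+ a ℕ.≤_) (sym 1+a≡m) 3+a≤m)) (ℕP.n≤1+n a)))
  valueβ<1−β⁻¹ (top 1+a≡m _ _) (same 2+a≡m _) = ⊥-elim (ℕP.1+n≢n (trans 2+a≡m (sym 1+a≡m)))

  β-valueβ-drop : ∀ ds i → βtimes m (valueβ (drop i ds)) ≡ ι (+ digitOr0 ds i) +β valueβ (drop (suc i) ds)
  β-valueβ-drop [] zero = Zβ-≡ refl (trans (+-identityˡ (M * 0ℤ)) (*-zeroʳ M))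
  β-valueβ-drop [] (suc i) = Zβ-≡ refl (trans (+-identityˡ (M * 0ℤ)) (*-zeroʳ M))
  β-valueβ-drop (a ∷ as) zero = β-β⁻¹ (ι (+ a) +β valueβ as)
  β-valueβ-drop (a ∷ as) (suc i) = β-valueβ-drop as i

  betaExp-valueβ : ∀ {ds} → Admissible ds → IsBetaExp m (valueβ ds) (λ i → + digitOr0 ds i)
  betaExp-valueβ {ds} adm = (λ i → valueβ (drop i ds)) , refl , λ i → floor i , step i
    where
    step : ∀ i → valueβ (drop (suc i) ds) ≡ βtimes m (valueβ (drop i ds)) −β ι (+ digitOr0 ds i)
    step i = ι+β⇒−βι (β-valueβ-drop ds i)
    floor : ∀ i → IsFloor m (βtimes m (valueβ (drop i ds))) (+ digitOr0 ds i)
    floor i = isFloor (βtimes m (valueβ (drop i ds))) (+ digitOr0 ds i)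
      (subst (NonNeg m) (step i) (valueβ-nonNeg (drop (suc i) ds)))
      (subst (λ G → Pos m (ι 1ℤ −β G)) (step i) (valueβ<1 (admissible-drop (suc i) adm)))

  private
    +-of-*+ : ∀ b u v → + (b ℕ.* u ℕ.+ v) ≡ + b * + u + + v
    +-of-*+ b u v = trans (ℤP.pos-+ (b ℕ.* u) v) (cong (_+ + v) (pos-* b u))

  U-recℤ : ∀ q → + U m (2 ℕ.+ q) ≡ M * + U m (1 ℕ.+ q) - + U m q
  U-recℤ q = trans (ring (+ U m (2 ℕ.+ q)) (+ U m q))
    (cong (_- + U m q) (trans (sym (ℤP.pos-+ (U m (2 ℕ.+ q)) (U m q)))
                               (trans (cong +_ (U-rec q)) (pos-* m (U m (1 ℕ.+ q))))))
    where
    ring : ∀ a b → a ≡ a + b - b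
    ring = solve-∀

  valueFrom-rec : ∀ as o → + valueFrom m as (2 ℕ.+ o) ≡ M * + valueFrom m as (1 ℕ.+ o) - + valueFrom m as o
  valueFrom-rec [] o = ring M
    where
    ring : ∀ M → 0ℤ ≡ M * 0ℤ - 0ℤ
    ring = solve-∀
  valueFrom-rec (b ∷ bs) o = begin
    + (b ℕ.* U m (2 ℕ.+ o) ℕ.+ valueFrom m bs (3 ℕ.+ o))
      ≡⟨ +-of-*+ b _ _ ⟩
    + b * u 2 + v 3
      ≡⟨ cong₂ (λ x y → + b * x + y) (U-recℤ o) (valueFrom-rec bs (suc o)) ⟩
    + b * (M * u 1 - u 0) + (M * v 2 - v 1)
      ≡⟨ ring (+ b) M (u 1) (u 0) (v 2) (v 1) ⟩
    M * (+ b * u 1 + v 2) - (+ b * u 0 + v 1)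
      ≡⟨ cong₂ (λ x y → M * x - y) (+-of-*+ b _ _) (+-of-*+ b _ _) ⟨
    M * + valueFrom m (b ∷ bs) (1 ℕ.+ o) - + valueFrom m (b ∷ bs) o ∎
    where
    open ≡-Reasoning
    u v : ℕ → ℤ
    u k = + U m (k ℕ.+ o)
    v k = + valueFrom m bs (k ℕ.+ o)
    ring : ∀ b M U₁ U₀ V₂ V₁ → b * (M * U₁ - U₀) + (M * V₂ - V₁) ≡ M * (b * U₁ + V₂) - (b * U₀ + V₁)
    ring = solve-∀

  valueβ-coordinates : ∀ as → valueβ as ≡ (+ valueFrom m as 1) ⊕ (- + valueFrom m as 0) β
  valueβ-coordinates [] = refl
  valueβ-coordinates (a ∷ as) rewrite valueβ-coordinates as =
    Zβ-≡ (trans (ring (+ a) M (+ valueFrom m as 1) (+ valueFrom m as 0))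
                (trans (cong (_+_ (+ a * M)) (sym (valueFrom-rec as 0))) (sym (+-of-*+ a m _))))
         (cong -_ (trans (cong (_+ + valueFrom m as 1) (sym (*-identityʳ (+ a)))) (sym (+-of-*+ a 1 _))))
    where
    ring : ∀ a M V₁ V₀ → (a + V₁) * M + (0ℤ + - V₀) ≡ a * M + (M * V₁ - V₀)
    ring = solve-∀

  divβ-value : ∀ ds → divβ m (value m ds) −β ι (+ value m (drop 1 ds)) ≡ valueβ ds
  divβ-value [] = refl
  divβ-value (a ∷ as) = trans (Zβ-≡ re-eq (+-identityʳ _)) (sym (valueβ-coordinates (a ∷ as)))
    where
    n = a ℕ.* 1 ℕ.+ valueFrom m as 1
    re-eq : + (n ℕ.* m) - + valueFrom m as 0 ≡ + valueFrom m (a ∷ as) 1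
    re-eq = begin
      + (n ℕ.* m) - + valueFrom m as 0
        ≡⟨ cong (_- + valueFrom m as 0) (trans (pos-* n m) (cong (_* M) (+-of-*+ a 1 _))) ⟩
      (+ a * 1ℤ + + valueFrom m as 1) * M - + valueFrom m as 0
        ≡⟨ ring (+ a) M (+ valueFrom m as 1) (+ valueFrom m as 0) ⟩
      + a * M + (M * + valueFrom m as 1 - + valueFrom m as 0)
        ≡⟨ cong (_+_ (+ a * M)) (valueFrom-rec as 0) ⟨
      + a * M + + valueFrom m as 2
        ≡⟨ +-of-*+ a m _ ⟨
      + valueFrom m (a ∷ as) 1 ∎
      where
      open ≡-Reasoning
      ring : ∀ a M V₁ V₀ → (a * 1ℤ + V₁) * M - V₀ ≡ a * M + (M * V₁ - V₀)
      ring = solve-∀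

open import Data.Nat using (ℕ; _≤_; _<_)
open import Data.Integer using (ℤ; +_; 1ℤ)
open import Data.List using (List; drop)
open import Data.Product using (Σ; _×_; _,_)
open import Relation.Binary.PropositionalEquality using (_≡_; refl; sym; subst)

proposition8 :
    (m : ℕ) → 3 ≤ m → (n : ℕ) → 0 < n → (ds : List ℕ) → UExp m n ds →
      Σ ℤ (IsFloor m (divβ m n))
      × ((k : ℤ) → IsFloor m (divβ m n) k →
          (Σ ℕ (λ j → (k ≡ + j) × UExp m j (drop 1 ds)))
          × Σ (ℕ → ℤ) (IsBetaExp m (divβ m n −β ι k))
          × ((d : ℕ → ℤ) → IsBetaExp m (divβ m n −β ι k) d →
              (i : ℕ) → d i ≡ + digitOr0 ds i))
proposition8 m 3≤m n _ ds expansion = (+ j , j-floor) , λ k k-floor →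
  let k≡j = floor-unique {divβ m n} k-floor j-floor in
  (j , k≡j , uExp-drop expansion) ,
  (digits , expansion-of k k≡j) ,
  λ d d-expansion → betaExp-unique d-expansion (expansion-of k k≡j)
  where
  open USequence m 3≤m
  open ZβOrder m 3≤m
  open BetaFraction m 3≤m
  j = value m (drop 1 ds)
  digits = λ i → + digitOr0 ds i
  admissible : Admissible ds
  admissible = greedy⇒admissible ds 0 0 (greedy (UExp.greedy expansion))
  fraction : divβ m n −β ι (+ j) ≡ valueβ ds
  fraction = subst (λ n → divβ m n −β ι (+ j) ≡ valueβ ds) (UExp.sums expansion) (divβ-value ds)
  j-floor : IsFloor m (divβ m n) (+ j)
  j-floor = isFloor (divβ m n) (+ j) (subst (NonNeg m) (sym fraction) (valueβ-nonNeg ds))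
    (subst (λ G → Pos m (ι 1ℤ −β G)) (sym fraction) (valueβ<1 admissible))
  expansion-of : ∀ k → k ≡ + j → IsBetaExp m (divβ m n −β ι k) digits
  expansion-of k refl = subst (λ x → IsBetaExp m x digits) (sym fraction) (betaExp-valueβ admissible)
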